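{- Let $k\in\mathbb{N}$. For every finite $(\Sigma,A)$-graph $\mathscr{G}$ that is $k$-DAG-decomposable, there is a $(\Sigma,A)$-graph $\mathscr{D}$ that is a BDAG of width $k$ and is bisimilar to $\mathscr{G}$.
   Context: A $(\Sigma,A)$-graph ($A$ a nonempty finite set of actions, $\Sigma$ an alphabet) is $(V,(E_a)_{a\in A},v_I,\lambda)$ with $V$ at most countable, $E_a\subseteq V\times V$, $v_I\in V$, $\lambda:V\to\Sigma$. It is a DAG iff it has no directed cycle in $\bigcup_a E_a$. It is a bottlenecked DAG (BDAG) of width $w$ iff it is a DAG and $V$ splits into pairwise disjoint sets $L_0,N_0,L_1,N_1,\dots$ with (i) $\bigcup_a E_a\subseteq\bigcup_i((L_i\times L_i)\cup(L_i\times N_i)\cup(N_i\times L_{i+1}))$, (ii) $w=\sup_i|N_i|$, (iii) each $L_i$ induces a subgraph with no infinite path. A feedback vertex set of a finite graph is a set $F\subseteq V$ whose removal leaves an acyclic graph (a set of finite DAGs). A finite graph is $k$-DAG-decomposable iff the minimal cardinality of a feedback vertex set is $k$. Graphs $\mathscr{G}=(V,(E_a),v_I,\lambda)$ and $\mathscr{G}'=(V',(E'_a),v'_I,\lambda')$ are bisimilar iff there is a relation $R\subseteq V\times V'$ with $(v_I,v'_I)\in R$ such that for all $(u,u')\in R$: $\lambda(u)=\lambda'(u')$; for every $a$ and $(u,v)\in E_a$ there is $v'$ with $(u',v')\in E'_a$ and $(v,v')\in R$; and for every $a$ and $(u',v')\in E'_a$ there is $v$ with $(u,v)\in E_a$ and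 $(v,v')\in R$. -}

module Defs where

open import Data.Nat using (ℕ; suc; _≤_)
open import Data.Bool using (Bool; true; false)
open import Data.Fin using (Fin)
open import Data.Product using (Σ; ∃; _×_; _,_; proj₁; proj₂)
open import Data.Sum using (_⊎_)
open import Data.List using (List; length)
open import Data.List.Membership.Propositional using (_∈_; _∉_)
open import Data.List.Relation.Unary.All using (All)
open import Data.List.Relation.Unary.Unique.Propositional using (Unique)
open import Relation.Nullary using (¬_)
open import Relation.Binary.PropositionalEquality using (_≡_)
open import Relation.Binary.Construct.Closure.Transitive using (TransClosure)
open import Function.Bundles using (_↔_)
open import Function.Definitions using (Injective)

-- A (Σ,A)-graph.  Edge relations E_a ⊆ V × V are given by their
-- characteristic functions (E a u v ≡ true  iff  (u,v) ∈ E_a).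
record Graph (Sig A : Set) : Set₁ where
  field
    V   : Set
    E   : A → V → V → Bool
    vI  : V
    lab : V → Sig

module _ {Sig A : Set} (G : Graph Sig A) where
  open Graph G

  Step : V → V → Set
  Step u v = ∃ λ a → E a u v ≡ true

  Countable : Set
  Countable = Σ (V → ℕ) Injective′
    where Injective′ = λ f → Injective _≡_ _≡_ f

  Finite : Set
  Finite = ∃ λ n → V ↔ Fin n

  IsDAG : Set
  IsDAG = ∀ v → ¬ TransClosure Step v v

  IsFeedbackVertexSet : List V → Set
  IsFeedbackVertexSet F =
    ∀ v → ¬ TransClosure (λ x y → x ∉ F × y ∉ F × Step x y) v v

  -- F (a duplicate-free list, i.e. a finite set) is a feedback vertex set
  -- of cardinality (length F)
  FVS : List V → Set
  FVS F = Unique F × IsFeedbackVertexSet F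

  DAGDecomposable : ℕ → Set
  DAGDecomposable k =
    (∃ λ F → FVS F × length F ≡ k) × (∀ F → FVS F → k ≤ length F)

  -- Bottleneck layering: layer v = (i , false) means v ∈ L_i,
  -- layer v = (i , true) means v ∈ N_i.  A function gives a partition
  -- into pairwise disjoint sets L_0, N_0, L_1, N_1, ...
  module _ (layer : V → ℕ × Bool) where
    InL InN : ℕ → V → Set
    InL i v = layer v ≡ (i , false)
    InN i v = layer v ≡ (i , true)

    EdgesOK : Set
    EdgesOK = ∀ u v → Step u v →
      ∃ λ i → (InL i u × InL i v) ⊎ (InL i u × InN i v) ⊎ (InN i u × InL (suc i) v)

    CardN≤ : ℕ → ℕ → Set
    CardN≤ i w = ∀ (S : List V) → Unique S → All (InN i) S → length S ≤ w

    CardN≥ : ℕ → ℕ → Set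
    CardN≥ i w = ∃ λ (S : List V) → Unique S × All (InN i) S × length S ≡ w

    -- w = sup_i |N_i|  (w a natural number: all |N_i| ≤ w and the bound is attained)
    WidthIs : ℕ → Set
    WidthIs w = (∀ i → CardN≤ i w) × (∃ λ i → CardN≥ i w)

    NoInfPathL : Set
    NoInfPathL = ∀ i → ¬ (∃ λ (f : ℕ → V) →
      ∀ n → InL i (f n) × InL i (f (suc n)) × Step (f n) (f (suc n)))

  IsBDAG : ℕ → Set
  IsBDAG w = IsDAG × (∃ λ layer → EdgesOK layer × WidthIs layer w × NoInfPathL layer)

Bisimilar : {Sig A : Set} → Graph Sig A → Graph Sig A → Set₁
Bisimilar {Sig} {A} G G′ =
  ∃ λ (R : G.V → G′.V → Set) → R G.vI G′.vI ×
    (∀ u u′ → R u u′ →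
        (G.lab u ≡ G′.lab u′)
      × (∀ a v → G.E a u v ≡ true → ∃ λ v′ → G′.E a u′ v′ ≡ true × R v v′)
      × (∀ a v′ → G′.E a u′ v′ ≡ true → ∃ λ v → G.E a u v ≡ true × R v v′))
  where
    module G = Graph G
    module G′ = Graph G′

-- Unfold G along a feedback vertex set F of size k: a copy of a vertex carries a level i, the
-- copies of vertices of F reached inside level i form the bottleneck N_i, and leaving N_i raises
-- the level. Every edge inside L_i enters a vertex outside F, so a cycle of the unfolding, or an
-- infinite path in L_i (by finiteness), projects to a cycle of G avoiding F. Each N_i consists of
-- copies of distinct vertices of F, and the projection of copies is a bisimulation.
module Submission where

open import Defs
open import Data.Nat using (ℕ; suc; _+_; _*_; _≤_; _<_; s≤s; z≤n)
open import Data.Nat.Properties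
  using (≤-reflexive; <⇒≢; ≤-<-trans; <-≤-trans; <-trans; n<1+n; +-suc; m≤n⇒m<n∨m≡n; +-cancelˡ-≡; *-cancelʳ-≡)
open import Data.Nat.DivMod using (_%_; [m+kn]%n≡m%n; m<n⇒m%n≡m)
open import Data.Fin using (Fin; toℕ)
open import Data.Fin.Properties using (toℕ-injective; toℕ<n; pigeonhole; inj⇒≟; 2↔Bool; *↔×)
import Data.Nat.Properties as ℕ
open import Data.Bool using (Bool; true; false; _∧_)
open import Data.Bool.Properties using (∧-conicalˡ; ∧-conicalʳ; T-≡; T-not-≡)
import Data.Bool.Properties as Bool
open import Data.Product using (Σ; ∃; _×_; _,_; proj₁; proj₂)
open import Data.Product.Properties using (≡-dec)
open import Data.Product.Function.NonDependent.Propositional using (_×-↔_)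
open import Data.Sum using (_⊎_; inj₁; inj₂)
open import Data.List using (List; []; _∷_; length; map)
open import Data.List.Properties using (length-map; length-removeAt′)
open import Data.List.Membership.Propositional using (_∈_; _∉_)
open import Data.List.Relation.Unary.Any using (here; there; _─_)
open import Data.List.Relation.Unary.All using (All; []; _∷_)
import Data.List.Relation.Unary.All as All
import Data.List.Relation.Unary.All.Properties as All
open import Data.List.Relation.Unary.AllPairs using ([]; _∷_)
open import Data.List.Relation.Unary.Unique.Propositional using (Unique)
import Data.List.Relation.Unary.Unique.Propositional.Properties as Unique
open import Relation.Nullary using (contradiction)
open import Relation.Nullary.Decidable using (isYes; toWitness; fromWitness; toWitnessFalse)
open import Relation.Binary.Definitions using (DecidableEquality)
open import Relation.Binary.PropositionalEquality using (_≡_; refl; sym; trans; cong; subst; _≢_; module ≡-Reasoning)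
open import Relation.Binary.Construct.Closure.Transitive using (TransClosure; [_]; _∷_; _++_)
open import Function using (_∘_; Injective)
open import Function.Bundles using (_↔_; Inverse; Injection; Equivalence)
open import Function.Properties.Inverse using (↔⇒↣)
open import Function.Construct.Composition using (_↔-∘_)
open import Function.Construct.Symmetry using (↔-sym)

module _ {X : Set} {R : X → X → Set} (f : ℕ → X) (chain : ∀ m → R (f m) (f (suc m))) where

  chain⇒TransClosure : ∀ {i j} → i < j → TransClosure R (f i) (f j)
  chain⇒TransClosure {i} {suc j} (s≤s i≤j) with m≤n⇒m<n∨m≡n i≤j
  ... | inj₁ i<j  = chain⇒TransClosure i<j ++ [ chain j ]
  ... | inj₂ refl = [ chain i ]

  finite-chain⇒cycle : ∀ {n} → X ↔ Fin n → ∃ λ x → TransClosure R x x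
  finite-chain⇒cycle {n} X↔Fin
    with i , j , i<j , fi≡fj ← pigeonhole (n<1+n n) (Inverse.to X↔Fin ∘ f ∘ toℕ)
    = f (toℕ j) , subst (λ x → TransClosure R x (f (toℕ j)))
                        (Injection.injective (↔⇒↣ X↔Fin) fi≡fj) (chain⇒TransClosure i<j)

module _ {X : Set} (P : X → Set) (R : X → X → Set) where

  TargetIn Within : X → X → Set
  TargetIn x y = P y × R x y
  Within x y = P x × P y × R x y

module _ {X : Set} {P : X → Set} {R : X → X → Set} where

  TargetIn⁺-target : ∀ {x y} → TransClosure (TargetIn P R) x y → P y
  TargetIn⁺-target [ py , _ ]  = py
  TargetIn⁺-target (_ ∷ steps) = TargetIn⁺-target steps

  TargetIn⁺⇒Within⁺ : ∀ {x y} → P x → TransClosure (TargetIn P R) x y → TransClosure (Within P R) x y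
  TargetIn⁺⇒Within⁺ px [ py , r ]           = [ px , py , r ]
  TargetIn⁺⇒Within⁺ px ((py , r) ∷ steps) = (px , py , r) ∷ TargetIn⁺⇒Within⁺ py steps

  TargetIn-cycle⇒Within-cycle : ∀ {x} → TransClosure (TargetIn P R) x x → TransClosure (Within P R) x x
  TargetIn-cycle⇒Within-cycle cycle = TargetIn⁺⇒Within⁺ (TargetIn⁺-target cycle) cycle

module Potential {X Y : Set} {S : X → X → Set} {T : Y → Y → Set} (pot : X → ℕ) (h : X → Y)
  (step : ∀ {x y} → S x y → pot x < pot y ⊎ (pot x ≡ pot y × T (h x) (h y))) where

  step⁺ : ∀ {x y} → TransClosure S x y → pot x < pot y ⊎ (pot x ≡ pot y × TransClosure T (h x) (h y))
  step⁺ [ s ] with step s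
  ... | inj₁ x<y           = inj₁ x<y
  ... | inj₂ (x≡y , t)     = inj₂ (x≡y , [ t ])
  step⁺ (s ∷ steps) with step s | step⁺ steps
  ... | inj₁ x<y       | inj₁ y<z          = inj₁ (<-trans x<y y<z)
  ... | inj₁ x<y       | inj₂ (y≡z , _)    = inj₁ (<-≤-trans x<y (≤-reflexive y≡z))
  ... | inj₂ (x≡y , _) | inj₁ y<z          = inj₁ (≤-<-trans (≤-reflexive x≡y) y<z)
  ... | inj₂ (x≡y , t) | inj₂ (y≡z , ts)   = inj₂ (trans x≡y y≡z , t ∷ ts)

  cycle⇒image-cycle : ∀ {x} → TransClosure S x x → TransClosure T (h x) (h x)
  cycle⇒image-cycle cycle with step⁺ cycle
  ... | inj₁ x<x      = contradiction refl (<⇒≢ x<x)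
  ... | inj₂ (_ , ts) = ts

  equal-potential-step : ∀ {x y} → pot x ≡ pot y → S x y → T (h x) (h y)
  equal-potential-step x≡y s with step s
  ... | inj₁ x<y     = contradiction x≡y (<⇒≢ x<y)
  ... | inj₂ (_ , t) = t

∈-─⁺ : ∀ {Y : Set} {x y : Y} {ys : List Y} (x∈ys : x ∈ ys) → y ∈ ys → x ≢ y → y ∈ (ys ─ x∈ys)
∈-─⁺ (here refl) (here refl)  x≢y = contradiction refl x≢y
∈-─⁺ (here refl) (there y∈ys) _   = y∈ys
∈-─⁺ (there _)   (here refl)  _   = here refl
∈-─⁺ (there x∈ys) (there y∈ys) x≢y = there (∈-─⁺ x∈ys y∈ys x≢y)

module _ {X Y : Set} {P : X → Set} (f : X → Y) (f-injective : ∀ {x y} → P x → P y → f x ≡ f y → x ≡ y) where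

  length-≤-injective : ∀ {xs ys} → Unique xs → All P xs → All (λ x → f x ∈ ys) xs → length xs ≤ length ys
  length-≤-injective {[]}     _              _          _ = z≤n
  length-≤-injective {x ∷ xs} {ys} (x∉xs ∷ xs!) (px ∷ pxs) (fx∈ys ∷ fxs∈ys) = begin
    suc (length xs)              ≤⟨ s≤s (length-≤-injective xs! pxs (fxs∈ys─fx x∉xs pxs fxs∈ys)) ⟩
    suc (length (ys ─ fx∈ys))    ≡⟨ sym (length-removeAt′ ys _) ⟩
    length ys                    ∎
    where
    open ℕ.≤-Reasoning
    fxs∈ys─fx : ∀ {zs} → All (x ≢_) zs → All P zs → All (λ z → f z ∈ ys) zs → All (λ z → f z ∈ (ys ─ fx∈ys)) zs
    fxs∈ys─fx []            []         []            = []
    fxs∈ys─fx (x≢z ∷ x≢zs) (pz ∷ pzs) (fz∈ys ∷ fzs) =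
      ∈-─⁺ fx∈ys fz∈ys (x≢z ∘ f-injective px pz) ∷ fxs∈ys─fx x≢zs pzs fzs

ℕ×Fin-injective : ∀ {d} {i j : ℕ} {r s : Fin d} → toℕ r + i * d ≡ toℕ s + j * d → i ≡ j × r ≡ s
ℕ×Fin-injective {d@(suc _)} {i} {j} {r} {s} eq = *-cancelʳ-≡ i j d (+-cancelˡ-≡ (toℕ r) _ _ eq′) , r≡s
  where
  open ≡-Reasoning
  remainder : ∀ k (t : Fin d) → (toℕ t + k * d) % d ≡ toℕ t
  remainder k t = trans ([m+kn]%n≡m%n (toℕ t) k d) (m<n⇒m%n≡m (toℕ<n t))
  r≡s : r ≡ s
  r≡s = toℕ-injective (begin
    toℕ r                ≡⟨ sym (remainder i r) ⟩
    (toℕ r + i * d) % d  ≡⟨ cong (_% d) eq ⟩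
    (toℕ s + j * d) % d  ≡⟨ remainder j s ⟩
    toℕ s                ∎)
  eq′ : toℕ r + i * d ≡ toℕ r + j * d
  eq′ = trans eq (cong (λ t → toℕ t + j * d) (sym r≡s))

ℕ×finite↣ℕ : ∀ {X : Set} {d} → X ↔ Fin d → Σ (ℕ × X → ℕ) (Injective _≡_ _≡_)
ℕ×finite↣ℕ {X} {d} X↔Fin = encode , encode-injective
  where
  open Injection (↔⇒↣ X↔Fin) using (to; injective)
  encode : ℕ × X → ℕ
  encode (i , x) = toℕ (to x) + i * d
  encode-injective : Injective _≡_ _≡_ encode
  encode-injective {i , x} {j , y} eq with refl , tx≡ty ← ℕ×Fin-injective {i = i} {j} eq =
    cong (i ,_) (injective tx≡ty)

module Unfolding {Sig A : Set} (G : Graph Sig A) {n} (V↔Fin : Graph.V G ↔ Fin n) (F : List (Graph.V G)) where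
  open Graph G

  open import Data.List.Membership.DecPropositional (inj⇒≟ (↔⇒↣ V↔Fin)) using (_∈?_)

  inF : V → Bool
  inF v = isYes (v ∈? F)

  inF⇒∈ : ∀ {v} → inF v ≡ true → v ∈ F
  inF⇒∈ = toWitness ∘ Equivalence.from T-≡

  inF⇒∉ : ∀ {v} → inF v ≡ false → v ∉ F
  inF⇒∉ = toWitnessFalse ∘ Equivalence.from T-not-≡

  ∈⇒inF : ∀ {v} → v ∈ F → inF v ≡ true
  ∈⇒inF = Equivalence.to T-≡ ∘ fromWitness

  -- The copy (i , b , v) lies in N_i if b = true and v ∈ F, and in L_i otherwise;
  -- b = false marks the successors of a bottleneck, which are forced into L_i.
  Copy : Set
  Copy = ℕ × Bool × V

  vertex : Copy → V
  vertex (_ , _ , v) = v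

  tag : Copy → ℕ × Bool
  tag (i , b , _) = i , b

  copy : ℕ × Bool → V → Copy
  copy (i , b) v = i , b , v

  level : Copy → ℕ × Bool
  level (i , b , v) = i , b ∧ inF v

  nextTag : ℕ × Bool → ℕ × Bool
  nextTag (i , true)  = suc i , false
  nextTag (i , false) = i , true

  _≟_ : DecidableEquality (ℕ × Bool)
  _≟_ = ≡-dec ℕ._≟_ Bool._≟_

  unfolded : Graph Sig A
  unfolded = record
    { V   = Copy
    ; E   = λ a x y → E a (vertex x) (vertex y) ∧ isYes (tag y ≟ nextTag (level x))
    ; vI  = 0 , true , vI
    ; lab = lab ∘ vertex
    }

  unfolded-step⁻ : ∀ {x y} → Step unfolded x y → Step G (vertex x) (vertex y) × tag y ≡ nextTag (level x)
  unfolded-step⁻ {x} {y} (a , e) = (a , ∧-conicalˡ _ _ e) ,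
    toWitness {a? = tag y ≟ nextTag (level x)} (Equivalence.from T-≡ (∧-conicalʳ (E a (vertex x) (vertex y)) _ e))

  unfolded-edge⁺ : ∀ {a} x w → E a (vertex x) w ≡ true → Graph.E unfolded a x (copy (nextTag (level x)) w) ≡ true
  unfolded-edge⁺ x w e = trans (cong (_∧ isYes (t ≟ t)) e) (Equivalence.to T-≡ (fromWitness {a? = t ≟ t} refl))
    where t = nextTag (level x)

  rank : ℕ × Bool → ℕ
  rank (i , false) = i + i
  rank (i , true)  = suc (i + i)

  rank-nextTag : ∀ t w → let t′ = level (copy (nextTag t) w) in rank t < rank t′ ⊎ (rank t ≡ rank t′ × w ∉ F)
  rank-nextTag (i , true)  w = inj₁ (s≤s (≤-reflexive (sym (+-suc i i))))
  rank-nextTag (i , false) w with inF w in w∈?F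
  ... | true  = inj₁ (n<1+n (i + i))
  ... | false = inj₂ (refl , inF⇒∉ w∈?F)

  rank-step : ∀ {x y} → Step unfolded x y →
    rank (level x) < rank (level y) ⊎ (rank (level x) ≡ rank (level y) × TargetIn (_∉ F) (Step G) (vertex x) (vertex y))
  rank-step {x} {y} s with unfolded-step⁻ s
  ... | g , refl with rank-nextTag (level x) (vertex y)
  ... | inj₁ lt         = inj₁ lt
  ... | inj₂ (eq , w∉F) = inj₂ (eq , w∉F , g)

  open Potential {S = Step unfolded} {T = TargetIn (_∉ F) (Step G)} (rank ∘ level) vertex rank-step

  module _ (fvs : IsFeedbackVertexSet G F) where

    unfolded-IsDAG : IsDAG unfolded
    unfolded-IsDAG x = fvs (vertex x) ∘ TargetIn-cycle⇒Within-cycle ∘ cycle⇒image-cycle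

    unfolded-NoInfPathL : NoInfPathL unfolded level
    unfolded-NoInfPathL i (f , path) = fvs _ (proj₂ (finite-chain⇒cycle (vertex ∘ f ∘ suc) chain V↔Fin))
      where
      into : ∀ m → TargetIn (_∉ F) (Step G) (vertex (f m)) (vertex (f (suc m)))
      into m with inL , inL′ , s ← path m = equal-potential-step (cong rank (trans inL (sym inL′))) s
      chain : ∀ m → Within (_∉ F) (Step G) (vertex (f (suc m))) (vertex (f (suc (suc m))))
      chain m = proj₁ (into m) , into (suc m)

  nextTag-levels : ∀ t w → ∃ λ i → let t′ = level (copy (nextTag t) w) in
    (t ≡ (i , false) × t′ ≡ (i , false)) ⊎ (t ≡ (i , false) × t′ ≡ (i , true)) ⊎ (t ≡ (i , true) × t′ ≡ (suc i , false))
  nextTag-levels (i , true)  w = i , inj₂ (inj₂ (refl , refl))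
  nextTag-levels (i , false) w with inF w
  ... | true  = i , inj₂ (inj₁ (refl , refl))
  ... | false = i , inj₁ (refl , refl)

  unfolded-EdgesOK : EdgesOK unfolded level
  unfolded-EdgesOK x y s with _ , refl ← unfolded-step⁻ s = nextTag-levels (level x) (vertex y)

  bottleneck-copy : ∀ {i} x → InN unfolded level i x → x ≡ (i , true , vertex x) × vertex x ∈ F
  bottleneck-copy (j , b , v) x∈Nᵢ
    with refl ← cong proj₁ x∈Nᵢ | refl ← ∧-conicalˡ b (inF v) (cong proj₂ x∈Nᵢ) =
    refl , inF⇒∈ (cong proj₂ x∈Nᵢ)

  bottlenecks-≤ : ∀ i → CardN≤ unfolded level i (length F)
  bottlenecks-≤ i S S! S⊆Nᵢ = length-≤-injective vertex vertex-injective S! S⊆Nᵢ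
    (All.map (proj₂ ∘ bottleneck-copy _) S⊆Nᵢ)
    where
    vertex-injective : ∀ {x y} → InN unfolded level i x → InN unfolded level i y → vertex x ≡ vertex y → x ≡ y
    vertex-injective {x} {y} x∈Nᵢ y∈Nᵢ eq = begin
      x                    ≡⟨ proj₁ (bottleneck-copy x x∈Nᵢ) ⟩
      i , true , vertex x  ≡⟨ cong (copy (i , true)) eq ⟩
      i , true , vertex y  ≡⟨ proj₁ (bottleneck-copy y y∈Nᵢ) ⟨
      y                    ∎
      where open ≡-Reasoning

  bottlenecks-≥ : Unique F → CardN≥ unfolded level 0 (length F)
  bottlenecks-≥ F! = map (copy (0 , true)) F , Unique.map⁺ (cong vertex) F!
    , All.map⁺ (All.tabulate (cong (0 ,_) ∘ ∈⇒inF)) , length-map _ F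

  unfolded-Countable : Countable unfolded
  unfolded-Countable = ℕ×finite↣ℕ (↔-sym *↔× ↔-∘ (↔-sym 2↔Bool ×-↔ V↔Fin))

  unfolded-Bisimilar : Bisimilar G unfolded
  unfolded-Bisimilar = (λ u x → u ≡ vertex x) , refl , λ { u x refl → refl , forth x , back x }
    where
    forth : ∀ x a w → E a (vertex x) w ≡ true → ∃ λ y → Graph.E unfolded a x y ≡ true × w ≡ vertex y
    forth x a w e = copy (nextTag (level x)) w , unfolded-edge⁺ x w e , refl
    back : ∀ x a y → Graph.E unfolded a x y ≡ true → ∃ λ w → E a (vertex x) w ≡ true × w ≡ vertex y
    back x a y e = vertex y , ∧-conicalˡ _ _ e , refl

lemma11 : (Sig A : Set) → (∃ λ m → A ↔ Fin (suc m)) → (k : ℕ) →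
    (G : Graph Sig A) → Finite G → DAGDecomposable G k →
    Σ (Graph Sig A) λ D → Countable D × IsBDAG D k × Bisimilar G D
lemma11 Sig A _ k G (n , V↔Fin) ((F , (F! , fvs) , refl) , _) =
  unfolded , unfolded-Countable ,
  (unfolded-IsDAG fvs , level , unfolded-EdgesOK , (bottlenecks-≤ , 0 , bottlenecks-≥ F!) , unfolded-NoInfPathL fvs) ,
  unfolded-Bisimilar
  where open Unfolding G V↔Fin F
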